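{- Let $G$ be a finite connected graph and $\mathcal{H}\subseteq E(G)$. Let $\mathcal{C}$ be a contracting set with respect to $\mathcal{H}$ with deleting set $\mathcal{D}$, let $e\in\mathcal{C}$, $f\in\mathcal{D}$, and suppose that either (i) $\mathcal{C}\cup\{f\}$ contains a cycle containing $e$, or (ii) $\mathcal{D}\cup\{e\}$ contains a cocycle containing $f$. Let $\mathcal{C}'=(\mathcal{C}\cup\{f\})\setminus\{e\}$. Then the multiset of (isomorphism classes of) blocks of $\mathcal{H}_\mathcal{C}$ equals the multiset of blocks of $\mathcal{H}_{\mathcal{C}'}$.
   Context: Graphs may have loops and multiple edges. A cycle is the edge set of a circuit (a loop is a cycle); a cocycle is a minimal set of edges whose removal disconnects the connected graph. A contracting set with respect to $\mathcal{H}$ is a set $\mathcal{C}\subseteq E(G)\setminus\mathcal{H}$ containing no cycle such that its deleting set $\mathcal{D}=E(G)\setminus(\mathcal{C}\cup\mathcal{H})$ contains no cocycle. $\mathcal{H}_\mathcal{C}$ is the graph obtained from $G$ by deleting all edges of $\mathcal{D}$ and contracting all edges of $\mathcal{C}$ (its edges are those of $\mathcal{H}$). The blocks of a graph are its maximal connected subgraphs without a cut vertex. -}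

module Defs where

open import Data.Nat using (ℕ; suc)
open import Data.Nat.DivMod using (_%_; m%n<n)
open import Data.Fin using (Fin; toℕ; fromℕ<)
open import Data.Fin.Subset using (Subset; _∈_; _∉_; _⊆_; _∪_; _∩_; ∁; ⁅_⁆; _-_; ⊤; Nonempty)
open import Data.Product using (Σ; ∃; ∃-syntax; _×_; _,_; proj₁; proj₂; map)
open import Data.Sum using (_⊎_)
open import Data.Empty using (⊥)
open import Data.List using (List; length; lookup)
open import Data.List.Membership.Propositional using () renaming (_∈_ to _∈ₗ_)
open import Data.List.Relation.Unary.Unique.Propositional using (Unique)
open import Relation.Nullary using (¬_)
open import Relation.Binary.PropositionalEquality using (_≡_)
open import Function.Bundles using (_⇔_; _⤖_; Bijection)
open import Function.Definitions using (Injective)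

-- Finite multigraphs (loops and multiple edges allowed).
-- Vertices are Fin nv, edges are Fin ne; each edge has an (unordered)
-- pair of ends, recorded as an ordered pair and always read up to swap.

record Graph : Set where
  field
    nv   : ℕ
    ne   : ℕ
    ends : Fin ne → Fin nv × Fin nv
open Graph public

EdgeSet : Graph → Set
EdgeSet Γ = Subset (ne Γ)

VertexSet : Graph → Set
VertexSet Γ = Subset (nv Γ)

Joins : (Γ : Graph) → Fin (ne Γ) → Fin (nv Γ) → Fin (nv Γ) → Set
Joins Γ e u w = (ends Γ e ≡ (u , w)) ⊎ (ends Γ e ≡ (w , u))

Incident : (Γ : Graph) → Fin (ne Γ) → Fin (nv Γ) → Set
Incident Γ e v = (proj₁ (ends Γ e) ≡ v) ⊎ (proj₂ (ends Γ e) ≡ v)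

data Reach (Γ : Graph) (S : EdgeSet Γ) : Fin (nv Γ) → Fin (nv Γ) → Set where
  here : ∀ {u} → Reach Γ S u u
  step : ∀ {u w v} (e : Fin (ne Γ)) → e ∈ S → Joins Γ e u w →
         Reach Γ S w v → Reach Γ S u v

ConnectedWith : (Γ : Graph) → EdgeSet Γ → Set
ConnectedWith Γ S = ∀ u v → Reach Γ S u v

Connected : Graph → Set
Connected Γ = ConnectedWith Γ ⊤

-- A circuit of length k+1 is a cyclic
-- sequence of pairwise distinct vertices v₀ … v_k and pairwise distinct
-- edges e₀ … e_k with e_i joining v_i and v_{i+1 mod (k+1)}.
-- (k = 0 : a loop; k = 1 : two parallel edges.)

cyc-next : ∀ {k} → Fin (suc k) → Fin (suc k)
cyc-next {k} i = fromℕ< (m%n<n (suc (toℕ i)) (suc k))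

IsCycle : (Γ : Graph) → EdgeSet Γ → Set
IsCycle Γ K =
  Σ ℕ λ k →
  Σ (Fin (suc k) → Fin (nv Γ)) λ vs →
  Σ (Fin (suc k) → Fin (ne Γ)) λ es →
    Injective _≡_ _≡_ vs ×
    Injective _≡_ _≡_ es ×
    (∀ i → Joins Γ (es i) (vs i) (vs (cyc-next i))) ×
    (∀ e → (e ∈ K) ⇔ (∃[ i ] es i ≡ e))

ContainsCycle : (Γ : Graph) → EdgeSet Γ → Set
ContainsCycle Γ S = ∃[ K ] (K ⊆ S × IsCycle Γ K)

IsCocycle : (Γ : Graph) → EdgeSet Γ → Set
IsCocycle Γ K =
  ¬ ConnectedWith Γ (∁ K) ×
  (∀ K' → K' ⊆ K → ¬ ConnectedWith Γ (∁ K') → K ⊆ K')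

ContainsCocycle : (Γ : Graph) → EdgeSet Γ → Set
ContainsCocycle Γ S = ∃[ K ] (K ⊆ S × IsCocycle Γ K)

DeletingSet : (Γ : Graph) → EdgeSet Γ → EdgeSet Γ → EdgeSet Γ
DeletingSet Γ H C = ∁ (C ∪ H)

IsContractingSet : (Γ : Graph) → (H C : EdgeSet Γ) → Set
IsContractingSet Γ H C =
  (∀ {e} → e ∈ C → e ∉ H) ×
  ¬ ContainsCycle Γ C ×
  ¬ ContainsCocycle Γ (DeletingSet Γ H C)

-- A realisation of the vertex set of H_C: the vertices of H_C are the
-- classes of vertices of G joined by walks in C, represented by a
-- surjection c : Fin nv → Fin k whose fibres are exactly these classes.
record Contraction (Γ : Graph) (C : EdgeSet Γ) : Set where
  field
    k        : ℕ
    cls      : Fin (nv Γ) → Fin k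
    cls-surj : ∀ x → ∃[ u ] cls u ≡ x
    cls-ker  : ∀ u v → (cls u ≡ cls v) ⇔ Reach Γ C u v
open Contraction public

-- The multigraph obtained from G by contracting C (edges of G with ends
-- mapped to classes).  H_C is its spanning subgraph with edge set H
-- (i.e. the edges of D are deleted, those of C contracted).
contractGraph : (Γ : Graph) (C : EdgeSet Γ) → Contraction Γ C → Graph
contractGraph Γ C κ = record
  { nv = k κ ; ne = ne Γ ; ends = λ e → map (cls κ) (cls κ) (ends Γ e) }

Sub : Graph → Set
Sub Γ = VertexSet Γ × EdgeSet Γ

IsSubgraph : (Γ : Graph) → Sub Γ → Set
IsSubgraph Γ (V , E) = ∀ e → e ∈ E → ∀ v → Incident Γ e v → v ∈ V

SubLe : (Γ : Graph) → Sub Γ → Sub Γ → Set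
SubLe Γ (V , E) (V' , E') = (V ⊆ V') × (E ⊆ E')

SubConnected : (Γ : Graph) → Sub Γ → Set
SubConnected Γ (V , E) =
  Nonempty V × (∀ u v → u ∈ V → v ∈ V → Reach Γ E u v)

-- v is a cut vertex of the subgraph (V , E): the edge set splits into two
-- nonempty parts whose only common vertex is v  (so that a loop together
-- with any further edge at its vertex yields a cut vertex).
HasCutVertex : (Γ : Graph) → Sub Γ → Set
HasCutVertex Γ (V , E) =
  Σ (Fin (nv Γ)) λ v → Σ (EdgeSet Γ) λ E₁ → Σ (EdgeSet Γ) λ E₂ →
    v ∈ V ×
    (E₁ ∪ E₂ ≡ E) ×
    (∀ e → e ∈ E₁ → e ∈ E₂ → ⊥) ×
    Nonempty E₁ × Nonempty E₂ ×
    (∀ w → (Σ (Fin (ne Γ)) λ e₁ → (e₁ ∈ E₁ × Incident Γ e₁ w)) →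
           (Σ (Fin (ne Γ)) λ e₂ → (e₂ ∈ E₂ × Incident Γ e₂ w)) → w ≡ v)

BlockLike : (Γ : Graph) → Sub Γ → Sub Γ → Set
BlockLike Γ X B =
  IsSubgraph Γ B × SubLe Γ B X × SubConnected Γ B × ¬ HasCutVertex Γ B

IsBlock : (Γ : Graph) → Sub Γ → Sub Γ → Set
IsBlock Γ X B = BlockLike Γ X B × (∀ B' → SubLe Γ B B' → BlockLike Γ X B' → SubLe Γ B' B)

BlockList : (Γ : Graph) → Sub Γ → List (Sub Γ) → Set
BlockList Γ X L = Unique L × (∀ B → (B ∈ₗ L) ⇔ IsBlock Γ X B)

SubIso : (Γ Γ' : Graph) → Sub Γ → Sub Γ' → Set
SubIso Γ Γ' (V , E) (V' , E') =
  Σ (Fin (nv Γ) → Fin (nv Γ')) λ φ →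
  Σ (Fin (ne Γ) → Fin (ne Γ')) λ ψ →
    (∀ v → v ∈ V → φ v ∈ V') ×
    (∀ u v → u ∈ V → v ∈ V → φ u ≡ φ v → u ≡ v) ×
    (∀ v' → v' ∈ V' → ∃[ v ] (v ∈ V × φ v ≡ v')) ×
    (∀ e → e ∈ E → ψ e ∈ E') ×
    (∀ e f → e ∈ E → f ∈ E → ψ e ≡ ψ f → e ≡ f) ×
    (∀ e' → e' ∈ E' → ∃[ e ] (e ∈ E × ψ e ≡ e')) ×
    (∀ e → e ∈ E → Joins Γ' (ψ e) (φ (proj₁ (ends Γ e))) (φ (proj₂ (ends Γ e))))

-- the multisets of isomorphism classes of blocks of X (in Γ) and of
-- X' (in Γ') coincide: for any enumerations of the blocks there is a
-- bijection between them matching isomorphic blocks.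
SameBlockMultiset : (Γ Γ' : Graph) → Sub Γ → Sub Γ' → Set
SameBlockMultiset Γ Γ' X X' =
  ∀ L L' → BlockList Γ X L → BlockList Γ' X' L' →
    Σ (Fin (length L) ⤖ Fin (length L')) λ π →
      ∀ i → SubIso Γ Γ' (lookup L i) (lookup L' (Bijection.to π i))

HC : (Γ : Graph) (H C : EdgeSet Γ) (κ : Contraction Γ C) → Sub (contractGraph Γ C κ)
HC Γ H C κ = ⊤ , H

-- Both H_C and H_C′ are glued from two pieces in the same way. In case (i) the cycle lets e
-- and f stand in for each other, so C and C′ join exactly the same vertices and H_C, H_C′
-- only differ in the names of their vertices (one piece). In case (ii) the cocycle splits
-- G into two shores, the two ends of e and of f lying on opposite shores; H avoids the
-- cocycle, and within a shore C and C′ join the same vertices, so H_C and H_C′ both consist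
-- of the same two pieces, glued at one vertex (the image of e, resp. of f). A block cannot
-- meet both pieces, since their common vertex would be a cut vertex; hence blocks correspond
-- bijectively, edge set for edge set, to isomorphic blocks.
module Submission where

open import Defs
open import Data.Bool using (Bool; true; false; not) renaming (_≟_ to _≟ᵇ_)
open import Data.Empty using (⊥; ⊥-elim)
open import Data.Unit using (tt) renaming (⊤ to ⊤ᵤ)
open import Data.Fin using (Fin; zero; suc; toℕ; inject₁; fromℕ; _≟_)
open import Data.Fin.Induction using (<-weakInduction; <-weakInduction-startingFrom)
open import Data.Fin.Properties
  using (toℕ-injective; toℕ-fromℕ<; toℕ-fromℕ; toℕ-inject₁; toℕ<n; ≤fromℕ; all?; any?)
open import Data.Fin.Subset
  using (Subset; _─_; inside; outside; _∈_; _∉_; _⊆_; _∪_; ∁; ⁅_⁆; _-_; ⊤; Nonempty; ∣_∣)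
open import Data.Fin.Subset.Properties
  using ( _∈?_; nonempty?; x∈⁅x⁆; x∈⁅y⁆⇒x≡y; x∈p∧x≢y⇒x∈p-y; p─q⊆p; x∈p⇒∣p-x∣<∣p∣; x∈p∪q⁻; x∈p∪q⁺
        ; x∈∁p⇒x∉p; x∉p⇒x∈∁p; ∈⊤; ⊆-antisym)
open import Data.Nat using (ℕ; zero; suc; _≤_; s≤s)
open import Data.Nat.DivMod using (_%_; m<n⇒m%n≡m; n%n≡0)
open import Data.Nat.Properties using (≤-refl; ≤-trans; ≤-pred)
open import Data.Product using (Σ; ∃; ∃-syntax; _×_; _,_; proj₁; proj₂)
import Data.Product as Product
open import Data.List using (List; length; lookup)
open import Data.List.Membership.Propositional using () renaming (_∈_ to _∈ₗ_)
open import Data.List.Membership.Propositional.Properties using (∈-lookup)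
open import Data.List.Relation.Unary.All as All using ()
open import Data.List.Relation.Unary.Any using (index)
open import Data.List.Relation.Unary.Any.Properties using (lookup-index)
open import Data.List.Relation.Unary.AllPairs using (_∷_)
open import Data.List.Relation.Unary.Unique.Propositional using (Unique)
open import Data.Sum using (_⊎_; inj₁; inj₂)
import Data.Sum as Sum
open import Data.Vec using (tabulate; _∷_)
open import Data.Vec.Base using (here; there)
open import Data.Vec.Properties using (lookup∘tabulate; lookup⇒[]=; []=⇒lookup)
open import Function using (_∘_; id; case_of_)
open import Function.Bundles using (_⇔_; mk⇔; Equivalence; _⤖_; mk⤖; Bijection)
open import Function.Properties.Equivalence using () renaming (sym to ⇔-sym)
open import Relation.Nullary using (¬_; Dec; yes; no; does; contradiction)
open import Relation.Nullary.Decidable using (dec-true; map; map′; ¬?; _⊎-dec_; _×-dec_)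
open import Relation.Binary.PropositionalEquality
  using (_≡_; _≢_; refl; sym; trans; cong; cong₂; subst; subst₂; module ≡-Reasoning)

fromDec : ∀ {n} {P : Fin n → Set} → (∀ x → Dec (P x)) → Subset n
fromDec P? = tabulate (λ x → does (P? x))

∈-fromDec⁺ : ∀ {n} {P : Fin n → Set} (P? : ∀ x → Dec (P x)) {x} → P x → x ∈ fromDec P?
∈-fromDec⁺ P? {x} px = lookup⇒[]= x _ (trans (lookup∘tabulate _ x) (dec-true (P? x) px))

∈-fromDec⁻ : ∀ {n} {P : Fin n → Set} (P? : ∀ x → Dec (P x)) {x} → x ∈ fromDec P? → P x
∈-fromDec⁻ P? {x} x∈ with P? x | trans (sym ([]=⇒lookup x∈)) (lookup∘tabulate (λ x → does (P? x)) x)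
... | yes px | _ = px
... | no _ | ()

x∈p─q⇒x∉q : ∀ {n} (p q : Subset n) {x} → x ∈ p ─ q → x ∉ q
x∈p─q⇒x∉q (inside ∷ p) (outside ∷ q) here ()
x∈p─q⇒x∉q (_ ∷ p) (_ ∷ q) (there x∈p─q) (there x∈q) = x∈p─q⇒x∉q p q x∈p─q x∈q

x∈p-y⇒x≢y : ∀ {n} (p : Subset n) {x y} → x ∈ p - y → x ≢ y
x∈p-y⇒x≢y p {y = y} x∈p-y refl = x∈p─q⇒x∉q p ⁅ y ⁆ x∈p-y (x∈⁅x⁆ y)

x∈p∪⁅y⁆∧x≢y⇒x∈p : ∀ {n} (p : Subset n) {x y} → x ∈ p ∪ ⁅ y ⁆ → x ≢ y → x ∈ p
x∈p∪⁅y⁆∧x≢y⇒x∈p p {y = y} x∈ x≢y with x∈p∪q⁻ p ⁅ y ⁆ x∈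
... | inj₁ x∈p = x∈p
... | inj₂ x∈⁅y⁆ = contradiction (x∈⁅y⁆⇒x≡y y x∈⁅y⁆) x≢y

module Walks (Γ : Graph) where

  joins-sym : ∀ {e u w} → Joins Γ e u w → Joins Γ e w u
  joins-sym = Sum.swap

  joins⇒incident : ∀ {e u w} → Joins Γ e u w → Incident Γ e u
  joins⇒incident (inj₁ refl) = inj₁ refl
  joins⇒incident (inj₂ refl) = inj₂ refl

  incident-joined : ∀ {e x y a} → Joins Γ e x y → Incident Γ e a → a ≡ x ⊎ a ≡ y
  incident-joined (inj₁ refl) (inj₁ refl) = inj₁ refl
  incident-joined (inj₁ refl) (inj₂ refl) = inj₂ refl
  incident-joined (inj₂ refl) (inj₁ refl) = inj₂ refl
  incident-joined (inj₂ refl) (inj₂ refl) = inj₁ refl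

  incident⇒joins : ∀ {e v} → Incident Γ e v → ∃[ w ] Joins Γ e v w
  incident⇒joins {e} (inj₁ refl) = proj₂ (ends Γ e) , inj₁ refl
  incident⇒joins {e} (inj₂ refl) = proj₁ (ends Γ e) , inj₂ refl

  infixr 5 _++_

  _++_ : ∀ {S u w v} → Reach Γ S u w → Reach Γ S w v → Reach Γ S u v
  here ++ q = q
  step e e∈S j p ++ q = step e e∈S j (p ++ q)

  edge : ∀ {S e u w} → e ∈ S → Joins Γ e u w → Reach Γ S u w
  edge e∈S j = step _ e∈S j here

  reverse : ∀ {S u v} → Reach Γ S u v → Reach Γ S v u
  reverse here = here
  reverse (step e e∈S j p) = reverse p ++ edge e∈S (joins-sym j)

  mono : ∀ {S T u v} → S ⊆ T → Reach Γ S u v → Reach Γ T u v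
  mono S⊆T here = here
  mono S⊆T (step e e∈S j p) = step e (S⊆T e∈S) j (mono S⊆T p)

  ends-reach : ∀ {S e x y} → Joins Γ e x y →
               Reach Γ S x y → Reach Γ S (proj₁ (ends Γ e)) (proj₂ (ends Γ e))
  ends-reach (inj₁ refl) r = r
  ends-reach (inj₂ refl) r = reverse r

  joined-by-reach : ∀ {S e x y} → Joins Γ e x y →
                    Reach Γ S (proj₁ (ends Γ e)) (proj₂ (ends Γ e)) → Reach Γ S x y
  joined-by-reach (inj₁ refl) r = r
  joined-by-reach (inj₂ refl) r = reverse r

  without : ∀ {S : EdgeSet Γ} {e g} → g ∈ S → g ≢ e → g ∈ S - e
  without = x∈p∧x≢y⇒x∈p-y

  reroute : ∀ {S T} e → S - e ⊆ T → Reach Γ T (proj₁ (ends Γ e)) (proj₂ (ends Γ e)) →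
            ∀ {u v} → Reach Γ S u v → Reach Γ T u v
  reroute e S-e⊆T detour here = here
  reroute e S-e⊆T detour (step g g∈S j p) with g ≟ e
  ... | no g≢e = step g (S-e⊆T (without g∈S g≢e)) j (reroute e S-e⊆T detour p)
  ... | yes refl = joined-by-reach j detour ++ reroute e S-e⊆T detour p

  -- cut at the first and the last use of e
  split : ∀ {S T} e → S - e ⊆ T → ∀ {u v} → Reach Γ S u v →
          Reach Γ T u v ⊎ (∃[ x ] (Incident Γ e x × Reach Γ T u x)) × (∃[ y ] (Incident Γ e y × Reach Γ T y v))
  split e S-e⊆T here = inj₁ here
  split e S-e⊆T (step g g∈S j p) with g ≟ e | split e S-e⊆T p
  ... | no g≢e | inj₁ q = inj₁ (step g (S-e⊆T (without g∈S g≢e)) j q)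
  ... | no g≢e | inj₂ ((x , x∼e , q) , r) = inj₂ ((x , x∼e , step g (S-e⊆T (without g∈S g≢e)) j q) , r)
  ... | yes refl | inj₁ q = inj₂ ((_ , joins⇒incident j , here) , (_ , joins⇒incident (joins-sym j) , q))
  ... | yes refl | inj₂ (_ , r) = inj₂ ((_ , joins⇒incident j , here) , r)

  ReachVia : EdgeSet Γ → Fin (ne Γ) → Fin (nv Γ) → Fin (nv Γ) → Set
  ReachVia S e u v = Reach Γ (S - e) u v
                   ⊎ (Reach Γ (S - e) u a × Reach Γ (S - e) b v)
                   ⊎ (Reach Γ (S - e) u b × Reach Γ (S - e) a v)
    where
      a b : Fin (nv Γ)
      a = proj₁ (ends Γ e)
      b = proj₂ (ends Γ e)

  Reach⇔ReachVia : ∀ {S e u v} → e ∈ S → Reach Γ S u v ⇔ ReachVia S e u v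
  Reach⇔ReachVia {S} {e} e∈S = mk⇔ to from
    where
      to : ∀ {u v} → Reach Γ S u v → ReachVia S e u v
      to r with split e id r
      ... | inj₁ r' = inj₁ r'
      ... | inj₂ ((_ , inj₁ refl , r₁) , (_ , inj₁ refl , r₂)) = inj₁ (r₁ ++ r₂)
      ... | inj₂ ((_ , inj₁ refl , r₁) , (_ , inj₂ refl , r₂)) = inj₂ (inj₁ (r₁ , r₂))
      ... | inj₂ ((_ , inj₂ refl , r₁) , (_ , inj₁ refl , r₂)) = inj₂ (inj₂ (r₁ , r₂))
      ... | inj₂ ((_ , inj₂ refl , r₁) , (_ , inj₂ refl , r₂)) = inj₁ (r₁ ++ r₂)
      from : ∀ {u v} → ReachVia S e u v → Reach Γ S u v
      from (inj₁ r) = mono (p─q⊆p _ _) r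
      from (inj₂ (inj₁ (r₁ , r₂))) = mono (p─q⊆p _ _) r₁ ++ edge e∈S (inj₁ refl) ++ mono (p─q⊆p _ _) r₂
      from (inj₂ (inj₂ (r₁ , r₂))) = mono (p─q⊆p _ _) r₁ ++ edge e∈S (inj₂ refl) ++ mono (p─q⊆p _ _) r₂

  private
    edgeless-reach : ∀ {S u v} → ¬ Nonempty S → Reach Γ S u v → u ≡ v
    edgeless-reach _ here = refl
    edgeless-reach S-empty (step e e∈S _ _) = contradiction (e , e∈S) S-empty

    reach?-bounded : ∀ n S → ∣ S ∣ ≤ n → ∀ u v → Dec (Reach Γ S u v)
    reach?-bounded n S size u v with nonempty? S
    ... | no S-empty = map′ (λ { refl → here }) (edgeless-reach S-empty) (u ≟ v)
    reach?-bounded zero S size u v | yes (e , e∈S) with () ← ≤-trans (x∈p⇒∣p-x∣<∣p∣ e∈S) size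
    reach?-bounded (suc n) S size u v | yes (e , e∈S) =
      map (⇔-sym (Reach⇔ReachVia e∈S))
          (reach u v ⊎-dec (reach u a ×-dec reach b v) ⊎-dec (reach u b ×-dec reach a v))
      where
        a b : Fin (nv Γ)
        a = proj₁ (ends Γ e)
        b = proj₂ (ends Γ e)
        reach : ∀ u v → Dec (Reach Γ (S - e) u v)
        reach = reach?-bounded n (S - e) (≤-pred (≤-trans (x∈p⇒∣p-x∣<∣p∣ e∈S) size))

  reach? : ∀ S u v → Dec (Reach Γ S u v)
  reach? S = reach?-bounded ∣ S ∣ S ≤-refl

  connected? : ∀ S → Dec (ConnectedWith Γ S)
  connected? S = all? (λ u → all? (λ v → reach? S u v))

cyc-next-inject₁ : ∀ {k} (i : Fin k) → cyc-next (inject₁ i) ≡ suc i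
cyc-next-inject₁ {k} i = toℕ-injective (begin
  toℕ (cyc-next (inject₁ i))     ≡⟨ toℕ-fromℕ< _ ⟩
  suc (toℕ (inject₁ i)) % suc k  ≡⟨ cong (λ m → suc m % suc k) (toℕ-inject₁ i) ⟩
  suc (toℕ i) % suc k            ≡⟨ m<n⇒m%n≡m (s≤s (toℕ<n i)) ⟩
  suc (toℕ i)                    ∎)
  where open ≡-Reasoning

cyc-next-fromℕ : ∀ k → cyc-next (fromℕ k) ≡ zero
cyc-next-fromℕ k = toℕ-injective (begin
  toℕ (cyc-next (fromℕ k))     ≡⟨ toℕ-fromℕ< _ ⟩
  suc (toℕ (fromℕ k)) % suc k  ≡⟨ cong (λ m → suc m % suc k) (toℕ-fromℕ k) ⟩
  suc k % suc k                ≡⟨ n%n≡0 (suc k) ⟩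
  0                            ∎)
  where open ≡-Reasoning

cyc-next-closed⇒all : ∀ {k} (P : Fin (suc k) → Set) → (∀ i → P i → P (cyc-next i)) →
                      ∀ {i} → P i → ∀ j → P j
cyc-next-closed⇒all {k} P closed {i} Pi = <-weakInduction P P₀ next-suc
  where
    next-suc : ∀ j → P (inject₁ j) → P (suc j)
    next-suc j = subst P (cyc-next-inject₁ j) ∘ closed (inject₁ j)
    P₀ : P zero
    P₀ = subst P (cyc-next-fromℕ k) (closed (fromℕ k) (<-weakInduction-startingFrom P Pi next-suc (≤fromℕ i)))

cycle-detour : ∀ {Γ K} → IsCycle Γ K → ∀ {e} → e ∈ K →
               Reach Γ (K - e) (proj₁ (ends Γ e)) (proj₂ (ends Γ e))
cycle-detour {Γ} {K} (k , vs , es , _ , es-injective , es-joins , ∈K⇔) {e} e∈K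
  with j , refl ← Equivalence.to (∈K⇔ e) e∈K = ends-reach (es-joins j) (reverse around)
  where
    open Walks Γ
    es∈K : ∀ i → es i ∈ K
    es∈K i = Equivalence.from (∈K⇔ (es i)) (i , refl)
    Around : Fin (suc k) → Set
    Around m = Reach Γ (K - es j) (vs (cyc-next j)) (vs j) ⊎ Reach Γ (K - es j) (vs (cyc-next j)) (vs m)
    closed : ∀ m → Around m → Around (cyc-next m)
    closed m (inj₁ r) = inj₁ r
    closed m (inj₂ r) with m ≟ j
    ... | yes refl = inj₁ r
    ... | no m≢j = inj₂ (r ++ edge (without (es∈K m) (m≢j ∘ es-injective)) (es-joins m))
    around : Reach Γ (K - es j) (vs (cyc-next j)) (vs j)
    around = Sum.[ id , id ] (cyc-next-closed⇒all Around closed (inj₂ here) j)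

module Cuts (Γ : Graph) where
  open Walks Γ

  private
    end₁ end₂ : Fin (ne Γ) → Fin (nv Γ)
    end₁ e = proj₁ (ends Γ e)
    end₂ e = proj₂ (ends Γ e)

    ends-in? : ∀ V e → Dec (end₁ e ∈ V × end₂ e ∈ V)
    ends-in? V e = (end₁ e ∈? V) ×-dec (end₂ e ∈? V)

  component : EdgeSet Γ → Fin (nv Γ) → VertexSet Γ
  component S u = fromDec (reach? S u)

  ∈component⁺ : ∀ {S u y} → Reach Γ S u y → y ∈ component S u
  ∈component⁺ {S} {u} = ∈-fromDec⁺ (reach? S u)

  ∈component⁻ : ∀ {S u y} → y ∈ component S u → Reach Γ S u y
  ∈component⁻ {S} {u} = ∈-fromDec⁻ (reach? S u)

  induced : VertexSet Γ → EdgeSet Γ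
  induced V = fromDec (ends-in? V)

  ∈induced⁺ : ∀ {V e x y} → Joins Γ e x y → x ∈ V → y ∈ V → e ∈ induced V
  ∈induced⁺ {V} (inj₁ refl) x∈V y∈V = ∈-fromDec⁺ (ends-in? V) (x∈V , y∈V)
  ∈induced⁺ {V} (inj₂ refl) x∈V y∈V = ∈-fromDec⁺ (ends-in? V) (y∈V , x∈V)

  induced-closed : ∀ {V x y} → Reach Γ (induced V) x y → x ∈ V → y ∈ V
  induced-closed here x∈V = x∈V
  induced-closed {V} (step e e∈ (inj₁ refl) p) _ = induced-closed p (proj₂ (∈-fromDec⁻ (ends-in? V) e∈))
  induced-closed {V} (step e e∈ (inj₂ refl) p) _ = induced-closed p (proj₁ (∈-fromDec⁻ (ends-in? V) e∈))

  Crosses : VertexSet Γ → Fin (nv Γ) → Fin (nv Γ) → Set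
  Crosses W x y = (x ∈ W × y ∉ W) ⊎ (x ∉ W × y ∈ W)

  crosses-sym : ∀ {W x y} → Crosses W x y → Crosses W y x
  crosses-sym (inj₁ (x∈W , y∉W)) = inj₂ (y∉W , x∈W)
  crosses-sym (inj₂ (x∉W , y∈W)) = inj₁ (y∈W , x∉W)

  private
    crosses? : ∀ W e → Dec (Crosses W (end₁ e) (end₂ e))
    crosses? W e = ((end₁ e ∈? W) ×-dec ¬? (end₂ e ∈? W)) ⊎-dec (¬? (end₁ e ∈? W) ×-dec (end₂ e ∈? W))

  δ : VertexSet Γ → EdgeSet Γ
  δ W = fromDec (crosses? W)

  ∈δ⇔ : ∀ {W e x y} → Joins Γ e x y → e ∈ δ W ⇔ Crosses W x y
  ∈δ⇔ {W} (inj₁ refl) = mk⇔ (∈-fromDec⁻ (crosses? W)) (∈-fromDec⁺ (crosses? W))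
  ∈δ⇔ {W} (inj₂ refl) = mk⇔ (crosses-sym ∘ ∈-fromDec⁻ (crosses? W)) (∈-fromDec⁺ (crosses? W) ∘ crosses-sym)

  ∉δ-within : ∀ {W e x y} → Joins Γ e x y → x ∈ W → y ∈ W → e ∈ ∁ (δ W)
  ∉δ-within j x∈W y∈W = x∉p⇒x∈∁p λ e∈δ → case Equivalence.to (∈δ⇔ j) e∈δ of λ
    { (inj₁ (_ , y∉W)) → y∉W y∈W ; (inj₂ (x∉W , _)) → x∉W x∈W }

  ∉δ-without : ∀ {W e x y} → Joins Γ e x y → x ∉ W → y ∉ W → e ∈ ∁ (δ W)
  ∉δ-without j x∉W y∉W = x∉p⇒x∈∁p λ e∈δ → case Equivalence.to (∈δ⇔ j) e∈δ of λ
    { (inj₁ (x∈W , _)) → x∉W x∈W ; (inj₂ (_ , y∈W)) → y∉W y∈W }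

  ∁δ-closed : ∀ {W x y} → Reach Γ (∁ (δ W)) x y → x ∈ W → y ∈ W
  ∁δ-closed here x∈W = x∈W
  ∁δ-closed {W} (step {w = w} e e∉δ j p) x∈W with w ∈? W
  ... | yes w∈W = ∁δ-closed p w∈W
  ... | no w∉W = contradiction (Equivalence.from (∈δ⇔ j) (inj₁ (x∈W , w∉W))) (x∈∁p⇒x∉p e∉δ)

  δ-isCocycle : ∀ {W w₀ u₀} → w₀ ∈ W → u₀ ∉ W →
                (∀ y → y ∈ W → Reach Γ (∁ (δ W)) w₀ y) → (∀ y → y ∉ W → Reach Γ (∁ (δ W)) y u₀) →
                IsCocycle Γ (δ W)
  δ-isCocycle {W} {w₀} {u₀} w₀∈W u₀∉W shore shore' = disconnected , minimal
    where
      disconnected : ¬ ConnectedWith Γ (∁ (δ W))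
      disconnected connected = u₀∉W (∁δ-closed (connected w₀ u₀) w₀∈W)

      minimal : ∀ K → K ⊆ δ W → ¬ ConnectedWith Γ (∁ K) → δ W ⊆ K
      minimal K K⊆δ K-disconnects {e} e∈δ with e ∈? K
      ... | yes e∈K = e∈K
      ... | no e∉K = contradiction (λ a b → to-w₀ a ++ reverse (to-w₀ b)) K-disconnects
        where
          lift : ∀ {x y} → Reach Γ (∁ (δ W)) x y → Reach Γ (∁ K) x y
          lift = mono (λ g∉δ → x∉p⇒x∈∁p (x∈∁p⇒x∉p g∉δ ∘ K⊆δ))
          u₀→w₀ : Reach Γ (∁ K) u₀ w₀
          u₀→w₀ with Equivalence.to (∈δ⇔ (inj₁ refl)) e∈δ
          ... | inj₁ (a∈W , b∉W) =
            reverse (lift (shore' _ b∉W)) ++ edge (x∉p⇒x∈∁p e∉K) (inj₂ refl) ++ reverse (lift (shore _ a∈W))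
          ... | inj₂ (a∉W , b∈W) =
            reverse (lift (shore' _ a∉W)) ++ edge (x∉p⇒x∈∁p e∉K) (inj₁ refl) ++ reverse (lift (shore _ b∈W))
          to-w₀ : ∀ y → Reach Γ (∁ K) y w₀
          to-w₀ y with y ∈? W
          ... | yes y∈W = reverse (lift (shore y y∈W))
          ... | no y∉W = lift (shore' y y∉W) ++ u₀→w₀

  -- The cut separating the component of v in G − X from the rest, X being the S-component of u.
  module _ (connected : Connected Γ) {S u v} (u↮v : ¬ Reach Γ S u v) where
    private
      X W : VertexSet Γ
      X = component S u
      W = component (induced (∁ X)) v

      W⊆∁X : W ⊆ ∁ X
      W⊆∁X y∈W = induced-closed (∈component⁻ y∈W) (x∉p⇒x∈∁p (u↮v ∘ ∈component⁻))

      W-grow : ∀ {e x y} → Joins Γ e x y → x ∈ W → y ∉ X → y ∈ W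
      W-grow j x∈W y∉X = ∈component⁺ (∈component⁻ x∈W ++ edge (∈induced⁺ j (W⊆∁X x∈W) (x∉p⇒x∈∁p y∉X)) j)

      S-closed : ∀ {e x y} → e ∈ S → Joins Γ e x y → x ∈ W → y ∈ W
      S-closed {y = y} e∈S j x∈W with y ∈? X
      ... | yes y∈X =
        contradiction (∈component⁺ (∈component⁻ y∈X ++ edge e∈S (joins-sym j))) (x∈∁p⇒x∉p (W⊆∁X x∈W))
      ... | no y∉X = W-grow j x∈W y∉X

      δW⊆∁S : δ W ⊆ ∁ S
      δW⊆∁S {e} e∈δ = x∉p⇒x∈∁p λ e∈S → case Equivalence.to (∈δ⇔ (inj₁ refl)) e∈δ of λ
        { (inj₁ (a∈W , b∉W)) → b∉W (S-closed e∈S (inj₁ refl) a∈W)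
        ; (inj₂ (a∉W , b∈W)) → a∉W (S-closed e∈S (inj₂ refl) b∈W) }

      u∉W : u ∉ W
      u∉W u∈W = x∈∁p⇒x∉p (W⊆∁X u∈W) (∈component⁺ here)

      shore : ∀ y → y ∈ W → Reach Γ (∁ (δ W)) v y
      shore y y∈W = walk (∈component⁻ y∈W) (∈component⁺ here)
        where
          walk : ∀ {x y} → Reach Γ (induced (∁ X)) x y → x ∈ W → Reach Γ (∁ (δ W)) x y
          walk here _ = here
          walk (step {w = w} e e∈ j p) x∈W = step e (∉δ-within j x∈W w∈W) j (walk p w∈W)
            where
              w∈W : w ∈ W
              w∈W = ∈component⁺ (∈component⁻ x∈W ++ edge e∈ j)

      shore-X : ∀ {x y} → Reach Γ S x y → x ∈ X → Reach Γ (∁ (δ W)) x y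
      shore-X here _ = here
      shore-X (step {w = w} e e∈S j p) x∈X = step e (∉δ-without j (∉W x∈X) (∉W w∈X)) j (shore-X p w∈X)
        where
          ∉W : ∀ {y} → y ∈ X → y ∉ W
          ∉W y∈X y∈W = x∈∁p⇒x∉p (W⊆∁X y∈W) y∈X
          w∈X : w ∈ X
          w∈X = ∈component⁺ (∈component⁻ x∈X ++ edge e∈S j)

      shore' : ∀ y → y ∉ W → Reach Γ (∁ (δ W)) y u
      shore' y y∉W = walk (connected y u) y∉W
        where
          walk : ∀ {y} → Reach Γ ⊤ y u → y ∉ W → Reach Γ (∁ (δ W)) y u
          walk here _ = here
          walk {y} (step {w = z} e _ j p) y∉W with y ∈? X | z ∈? W
          ... | yes y∈X | _ = reverse (shore-X (∈component⁻ y∈X) (∈component⁺ here))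
          ... | no y∉X | yes z∈W = contradiction (W-grow (joins-sym j) z∈W y∉X) y∉W
          ... | no y∉X | no z∉W = step e (∉δ-without j y∉W z∉W) j (walk p z∉W)

    disconnected⇒cocycle : ContainsCocycle Γ (∁ S)
    disconnected⇒cocycle = δ W , δW⊆∁S , δ-isCocycle (∈component⁺ here) u∉W shore shore'

  no-cocycle⇒connected : Connected Γ → ∀ S → ¬ ContainsCocycle Γ (∁ S) → ConnectedWith Γ S
  no-cocycle⇒connected connected S no-cocycle u v with reach? S u v
  ... | yes r = r
  ... | no u↮v = contradiction (disconnected⇒cocycle connected u↮v) no-cocycle

module Blocks (Γ : Graph) (H : EdgeSet Γ) where
  open Walks Γ

  X : Sub Γ
  X = ⊤ , H

  private
    touches? : ∀ E v → Dec (∃[ h ] (h ∈ E × Incident Γ h v))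
    touches? E v = any? (λ h → (h ∈? E) ×-dec ((proj₁ (ends Γ h) ≟ v) ⊎-dec (proj₂ (ends Γ h) ≟ v)))

  endpoints : EdgeSet Γ → VertexSet Γ
  endpoints E = fromDec (touches? E)

  ∈endpoints⁺ : ∀ {E h v} → h ∈ E → Incident Γ h v → v ∈ endpoints E
  ∈endpoints⁺ {E} h∈E h∼v = ∈-fromDec⁺ (touches? E) (_ , h∈E , h∼v)

  ∈endpoints⁻ : ∀ {E v} → v ∈ endpoints E → ∃[ h ] (h ∈ E × Incident Γ h v)
  ∈endpoints⁻ {E} = ∈-fromDec⁻ (touches? E)

  endpoints-mono : ∀ {E E'} → E ⊆ E' → endpoints E ⊆ endpoints E'
  endpoints-mono E⊆E' v∈ with h , h∈E , h∼v ← ∈endpoints⁻ v∈ = ∈endpoints⁺ (E⊆E' h∈E) h∼v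

  -- a connected subgraph with an edge has no isolated vertex
  blockLike-vertices : ∀ {V E e} → BlockLike Γ X (V , E) → e ∈ E → V ≡ endpoints E
  blockLike-vertices {V} {E} {e} (subgraph , _ , (_ , connected) , _) e∈E = ⊆-antisym V⊆ ⊆V
    where
      ⊆V : endpoints E ⊆ V
      ⊆V v∈ with h , h∈E , h∼v ← ∈endpoints⁻ v∈ = subgraph h h∈E _ h∼v
      V⊆ : V ⊆ endpoints E
      V⊆ v∈V with connected _ (proj₁ (ends Γ e)) v∈V (subgraph e e∈E _ (inj₁ refl))
      ... | here = ∈endpoints⁺ e∈E (inj₁ refl)
      ... | step g g∈E j _ = ∈endpoints⁺ g∈E (joins⇒incident j)

  single-edge-blockLike : ∀ {h} → h ∈ H → BlockLike Γ X (endpoints ⁅ h ⁆ , ⁅ h ⁆)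
  single-edge-blockLike {h} h∈H =
    (λ _ g∈ _ → ∈endpoints⁺ g∈) , ((λ _ → ∈⊤) , λ g∈ → subst (_∈ H) (sym (x∈⁅y⁆⇒x≡y h g∈)) h∈H) ,
    ((_ , ∈endpoints⁺ (x∈⁅x⁆ h) (inj₁ refl)) , connected) , no-cut
    where
      h-incident : ∀ {v} → v ∈ endpoints ⁅ h ⁆ → Incident Γ h v
      h-incident v∈ with g , g∈ , g∼v ← ∈endpoints⁻ v∈ = subst (λ g → Incident Γ g _) (x∈⁅y⁆⇒x≡y h g∈) g∼v
      connected : ∀ u v → u ∈ endpoints ⁅ h ⁆ → v ∈ endpoints ⁅ h ⁆ → Reach Γ ⁅ h ⁆ u v
      connected u v u∈ v∈ with h-incident u∈ | h-incident v∈
      ... | inj₁ refl | inj₁ refl = here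
      ... | inj₁ refl | inj₂ refl = edge (x∈⁅x⁆ h) (inj₁ refl)
      ... | inj₂ refl | inj₁ refl = edge (x∈⁅x⁆ h) (inj₂ refl)
      ... | inj₂ refl | inj₂ refl = here
      no-cut : ¬ HasCutVertex Γ (endpoints ⁅ h ⁆ , ⁅ h ⁆)
      no-cut (_ , E₁ , E₂ , _ , E₁∪E₂≡ , disjoint , (g₁ , g₁∈) , (g₂ , g₂∈) , _) =
        disjoint h (subst (_∈ E₁) (is-h (x∈p∪q⁺ (inj₁ g₁∈))) g₁∈) (subst (_∈ E₂) (is-h (x∈p∪q⁺ (inj₂ g₂∈))) g₂∈)
        where
          is-h : ∀ {g} → g ∈ E₁ ∪ E₂ → g ≡ h
          is-h g∈ = x∈⁅y⁆⇒x≡y h (subst (_ ∈_) E₁∪E₂≡ g∈)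

  edgeless-isBlock : (∀ h → h ∉ H) → (∀ u v → u ≡ v) → Fin (nv Γ) → ∀ {E} → (∀ h → h ∉ E) → IsBlock Γ X (⊤ , E)
  edgeless-isBlock no-H one-vertex v {E} E-empty =
    ((λ e e∈E → contradiction e∈E (E-empty e)) , ((λ _ → ∈⊤) , λ {e} e∈E → contradiction e∈E (E-empty e)) ,
     ((v , ∈⊤) , λ a b _ _ → subst (Reach Γ E a) (one-vertex a b) here) ,
     λ { (_ , E₁ , E₂ , _ , E₁∪E₂≡ , _ , (e , e∈E₁) , _) →
           E-empty e (subst (e ∈_) E₁∪E₂≡ (x∈p∪q⁺ (inj₁ e∈E₁))) }) ,
    λ _ _ blockLike → (λ _ → ∈⊤) , λ {e} e∈ → contradiction (proj₂ (proj₁ (proj₂ blockLike)) e∈) (no-H e)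

  module _ (H-connected : ConnectedWith Γ H) where

    H-edge-at : ∀ {h} → h ∈ H → ∀ v → ∃[ g ] (g ∈ H × Incident Γ g v)
    H-edge-at {h} h∈H v with H-connected v (proj₁ (ends Γ h))
    ... | here = h , h∈H , inj₁ refl
    ... | step g g∈H j _ = g , g∈H , joins⇒incident j

    private
      trivial : ∀ {E u v} → (∀ h → h ∉ E) → Reach Γ E u v → u ≡ v
      trivial _ here = refl
      trivial E-empty (step g g∈E _ _) = contradiction g∈E (E-empty g)

    -- by maximality, an edgeless block has no H-edge at its vertex
    edgeless-block : ∀ {V E} → IsBlock Γ X (V , E) → (∀ h → h ∉ E) → (∀ h → h ∉ H) × V ≡ ⊤
    edgeless-block {V} {E} ((_ , _ , ((v₀ , v₀∈V) , V-connected) , _) , maximal) E-empty =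
      no-H , ⊆-antisym (λ _ → ∈⊤) λ {x} _ → subst (_∈ V) (trivial no-H (H-connected v₀ x)) v₀∈V
      where
        no-H : ∀ h → h ∉ H
        no-H h h∈H with g , g∈H , g∼v₀ ← H-edge-at h∈H v₀ =
          E-empty g (proj₂ (maximal _ (V⊆ , λ {e} e∈E → contradiction e∈E (E-empty e))
                                        (single-edge-blockLike g∈H))
                           (x∈⁅x⁆ g))
          where
            V⊆ : V ⊆ endpoints ⁅ g ⁆
            V⊆ x∈V = subst (_∈ endpoints ⁅ g ⁆) (trivial E-empty (V-connected v₀ _ v₀∈V x∈V))
                           (∈endpoints⁺ (x∈⁅x⁆ g) g∼v₀)

    no-H⇒one-vertex : (∀ h → h ∉ H) → ∀ u v → u ≡ v
    no-H⇒one-vertex no-H u v = trivial no-H (H-connected u v)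

    block-unique : ∀ {B₁ B₂} → IsBlock Γ X B₁ → IsBlock Γ X B₂ → proj₂ B₁ ≡ proj₂ B₂ → B₁ ≡ B₂
    block-unique {V₁ , E} {V₂ , .E} b₁ b₂ refl with nonempty? E
    ... | yes (e , e∈E) =
      cong (_, E) (trans (blockLike-vertices (proj₁ b₁) e∈E) (sym (blockLike-vertices (proj₁ b₂) e∈E)))
    ... | no E-empty =
      cong (_, E) (trans (proj₂ (edgeless-block b₁ empty)) (sym (proj₂ (edgeless-block b₂ empty))))
      where
        empty : ∀ h → h ∉ E
        empty h h∈E = E-empty (h , h∈E)

graphOn : (a n : ℕ) → (Fin n → Fin a × Fin a) → Graph
graphOn a n en = record { nv = a ; ne = n ; ends = en }

Shared : (Γ : Graph) → EdgeSet Γ → (Fin (ne Γ) → Bool) → Fin (nv Γ) → Set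
Shared Γ H side w = (∃[ h ] (h ∈ H × side h ≡ true × Incident Γ h w))
                   × (∃[ h ] (h ∈ H × side h ≡ false × Incident Γ h w))

SharedUnique : (Γ : Graph) → EdgeSet Γ → (Fin (ne Γ) → Bool) → Set
SharedUnique Γ H side = ∀ {w w'} → Shared Γ H side w → Shared Γ H side w' → w ≡ w'

-- Two graphs on the same edges whose H-edges are split into two sides, each side carried
-- isomorphically onto the other graph by to s / from s, the sides meeting in at most one
-- vertex in each graph.
record SideIso : Set where
  field
    n a a' : ℕ
    en : Fin n → Fin a × Fin a
    en' : Fin n → Fin a' × Fin a'
    H : Subset n
    side : Fin n → Bool
    to : Bool → Fin a → Fin a'
    from : Bool → Fin a' → Fin a
    to-joins : ∀ s h → h ∈ H → side h ≡ s →
               Joins (graphOn a' n en') h (to s (proj₁ (en h))) (to s (proj₂ (en h)))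
    from-joins : ∀ s h → h ∈ H → side h ≡ s →
                 Joins (graphOn a n en) h (from s (proj₁ (en' h))) (from s (proj₂ (en' h)))
    from-to : ∀ s h v → h ∈ H → side h ≡ s → Incident (graphOn a n en) h v → from s (to s v) ≡ v
    to-from : ∀ s h v → h ∈ H → side h ≡ s → Incident (graphOn a' n en') h v → to s (from s v) ≡ v
    shared-unique : SharedUnique (graphOn a n en) H side
    shared-unique' : SharedUnique (graphOn a' n en') H side

SideIso-sym : SideIso → SideIso
SideIso-sym I = record
  { n = n ; a = a' ; a' = a ; en = en' ; en' = en ; H = H ; side = side ; to = from ; from = to
  ; to-joins = from-joins ; from-joins = to-joins ; from-to = to-from ; to-from = from-to
  ; shared-unique = shared-unique' ; shared-unique' = shared-unique }
  where open SideIso I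

module BlockTransfer (I : SideIso) where
  open SideIso I
  Γ Γ' : Graph
  Γ = graphOn a n en
  Γ' = graphOn a' n en'
  open Walks Γ
  open Blocks Γ H
  module W' = Walks Γ'
  module B' = Blocks Γ' H

  SideIncident : Subset n → Bool → Fin a → Set
  SideIncident E b w = ∃[ h ] (h ∈ E × side h ≡ b × Incident Γ h w)

  meet : ∀ {E x y} → Reach Γ E x y → SideIncident E true x → SideIncident E false y →
         ∃[ w ] (SideIncident E true w × SideIncident E false w)
  meet here t f = _ , t , f
  meet (step g g∈E j p) t f with side g in sg
  ... | true = meet p (g , g∈E , sg , joins⇒incident (joins-sym j)) f
  ... | false = _ , t , (g , g∈E , sg , joins⇒incident j)

  restrict : Subset n → Bool → Subset n
  restrict E b = fromDec (λ h → (h ∈? E) ×-dec (side h ≟ᵇ b))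

  ∈restrict⁺ : ∀ {E b h} → h ∈ E → side h ≡ b → h ∈ restrict E b
  ∈restrict⁺ {E} {b} h∈E sh = ∈-fromDec⁺ (λ h → (h ∈? E) ×-dec (side h ≟ᵇ b)) (h∈E , sh)

  ∈restrict⁻ : ∀ {E b h} → h ∈ restrict E b → h ∈ E × side h ≡ b
  ∈restrict⁻ {E} {b} = ∈-fromDec⁻ (λ h → (h ∈? E) ×-dec (side h ≟ᵇ b))

  restrict-partition : ∀ E → restrict E true ∪ restrict E false ≡ E
  restrict-partition E = ⊆-antisym (Sum.[ proj₁ ∘ ∈restrict⁻ , proj₁ ∘ ∈restrict⁻ ] ∘ x∈p∪q⁻ _ _) split-side
    where
      split-side : E ⊆ restrict E true ∪ restrict E false
      split-side {h} h∈E with side h in sh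
      ... | true = x∈p∪q⁺ (inj₁ (∈restrict⁺ h∈E sh))
      ... | false = x∈p∪q⁺ (inj₂ (∈restrict⁺ h∈E sh))

  -- the vertex where the two sides meet would be a cut vertex
  two-sides⇒cut : ∀ {V E x y} → BlockLike Γ X (V , E) → SideIncident E true x → SideIncident E false y →
                  HasCutVertex Γ (V , E)
  two-sides⇒cut {V} {E} (subgraph , (_ , E⊆H) , (_ , connected) , _) t@(_ , h∈E , _ , h∼x) f@(_ , g∈E , _ , g∼y)
    with w , tw@(h₁ , h₁∈E , s₁ , h₁∼w) , fw@(h₂ , h₂∈E , s₂ , h₂∼w)
           ← meet (connected _ _ (subgraph _ h∈E _ h∼x) (subgraph _ g∈E _ g∼y)) t f =
    w , restrict E true , restrict E false , subgraph h₁ h₁∈E w h₁∼w , restrict-partition E ,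
    (λ e e∈t e∈f → contradiction (trans (sym (proj₂ (∈restrict⁻ e∈t))) (proj₂ (∈restrict⁻ e∈f))) λ ()) ,
    (h₁ , ∈restrict⁺ h₁∈E s₁) , (h₂ , ∈restrict⁺ h₂∈E s₂) ,
    λ w' (_ , e₁∈ , e₁∼w') (_ , e₂∈ , e₂∼w') →
      shared-unique (shared (side-incident e₁∈ e₁∼w') (side-incident e₂∈ e₂∼w')) (shared tw fw)
    where
      side-incident : ∀ {b h w} → h ∈ restrict E b → Incident Γ h w → SideIncident E b w
      side-incident h∈ h∼w = _ , proj₁ (∈restrict⁻ h∈) , proj₂ (∈restrict⁻ h∈) , h∼w
      shared : ∀ {w} → SideIncident E true w → SideIncident E false w → Shared Γ H side w
      shared (h₁ , h₁∈E , s₁ , h₁∼w) (h₂ , h₂∈E , s₂ , h₂∼w) =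
        (h₁ , E⊆H h₁∈E , s₁ , h₁∼w) , (h₂ , E⊆H h₂∈E , s₂ , h₂∼w)

  one-sided : ∀ {V E} → BlockLike Γ X (V , E) → ∀ {e h} → e ∈ E → h ∈ E → side h ≡ side e
  one-sided blockLike@(_ , _ , _ , no-cut) {e} {h} e∈E h∈E with side e in se | side h in sh
  ... | true | true = refl
  ... | false | false = refl
  ... | true | false =
    contradiction (two-sides⇒cut blockLike (e , e∈E , se , inj₁ refl) (h , h∈E , sh , inj₁ refl)) no-cut
  ... | false | true =
    contradiction (two-sides⇒cut blockLike (h , h∈E , sh , inj₁ refl) (e , e∈E , se , inj₁ refl)) no-cut

  module OneSide (s : Bool) {E : Subset n} (E⊆H : E ⊆ H) (E-side : ∀ {h} → h ∈ E → side h ≡ s) where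

    to-joins′ : ∀ {h u w} → h ∈ E → Joins Γ h u w → Joins Γ' h (to s u) (to s w)
    to-joins′ h∈E (inj₁ refl) = to-joins s _ (E⊆H h∈E) (E-side h∈E)
    to-joins′ h∈E (inj₂ refl) = W'.joins-sym (to-joins s _ (E⊆H h∈E) (E-side h∈E))

    from-joins′ : ∀ {h u w} → h ∈ E → Joins Γ' h u w → Joins Γ h (from s u) (from s w)
    from-joins′ h∈E (inj₁ refl) = from-joins s _ (E⊆H h∈E) (E-side h∈E)
    from-joins′ h∈E (inj₂ refl) = joins-sym (from-joins s _ (E⊆H h∈E) (E-side h∈E))

    to-incident : ∀ {h v} → h ∈ E → Incident Γ h v → Incident Γ' h (to s v)
    to-incident h∈E h∼v = W'.joins⇒incident (to-joins′ h∈E (proj₂ (incident⇒joins h∼v)))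

    from-incident : ∀ {h v} → h ∈ E → Incident Γ' h v → Incident Γ h (from s v)
    from-incident h∈E h∼v = joins⇒incident (from-joins′ h∈E (proj₂ (W'.incident⇒joins h∼v)))

    to-reach : ∀ {u v} → Reach Γ E u v → Reach Γ' E (to s u) (to s v)
    to-reach here = here
    to-reach (step g g∈E j p) = step g g∈E (to-joins′ g∈E j) (to-reach p)

    module _ {V e₀} (e₀∈E : e₀ ∈ E) (blockLike : BlockLike Γ X (V , E)) where
      private
        subgraph : IsSubgraph Γ (V , E)
        subgraph = proj₁ blockLike
        connected : ∀ u v → u ∈ V → v ∈ V → Reach Γ E u v
        connected = proj₂ (proj₁ (proj₂ (proj₂ blockLike)))
        no-cut : ¬ HasCutVertex Γ (V , E)
        no-cut = proj₂ (proj₂ (proj₂ blockLike))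
        edge-at : ∀ {v} → v ∈ V → ∃[ h ] (h ∈ E × Incident Γ h v)
        edge-at v∈V = ∈endpoints⁻ (subst (_ ∈_) (blockLike-vertices blockLike e₀∈E) v∈V)

      from-endpoints : ∀ {v'} → v' ∈ B'.endpoints E → from s v' ∈ V × to s (from s v') ≡ v'
      from-endpoints v'∈ with h , h∈E , h∼v' ← B'.∈endpoints⁻ v'∈ =
        subgraph h h∈E _ (from-incident h∈E h∼v') , to-from s h _ (E⊆H h∈E) (E-side h∈E) h∼v'

      from-to-V : ∀ {v} → v ∈ V → from s (to s v) ≡ v
      from-to-V v∈V with h , h∈E , h∼v ← edge-at v∈V =
        from-to s h _ (E⊆H h∈E) (E-side h∈E) h∼v

      transfer : BlockLike Γ' B'.X (B'.endpoints E , E)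
      transfer = (λ _ e∈E _ → B'.∈endpoints⁺ e∈E) , ((λ _ → ∈⊤) , E⊆H) ,
                 ((_ , B'.∈endpoints⁺ e₀∈E (inj₁ refl)) , connected') , no-cut'
        where
          connected' : ∀ u v → u ∈ B'.endpoints E → v ∈ B'.endpoints E → Reach Γ' E u v
          connected' u v u∈ v∈ with u∈V , u≡ ← from-endpoints u∈ | v∈V , v≡ ← from-endpoints v∈ =
            subst₂ (Reach Γ' E) u≡ v≡ (to-reach (connected _ _ u∈V v∈V))
          -- a cut vertex v' of the image pulls back to the cut vertex from s v'
          no-cut' : ¬ HasCutVertex Γ' (B'.endpoints E , E)
          no-cut' (v' , E₁ , E₂ , v'∈ , E₁∪E₂≡ , disjoint , ne₁ , ne₂ , meets-at-v') =
            no-cut (from s v' , E₁ , E₂ , proj₁ (from-endpoints v'∈) , E₁∪E₂≡ , disjoint , ne₁ , ne₂ , meets-at)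
            where
              meets-at : ∀ w → (Σ (Fin n) λ e₁ → e₁ ∈ E₁ × Incident Γ e₁ w) →
                         (Σ (Fin n) λ e₂ → e₂ ∈ E₂ × Incident Γ e₂ w) → w ≡ from s v'
              meets-at w (e₁ , e₁∈ , e₁∼w) (e₂ , e₂∈ , e₂∼w) =
                trans (sym (from-to s e₁ w (E⊆H e₁∈E) (E-side e₁∈E) e₁∼w))
                      (cong (from s) (meets-at-v' (to s w) (e₁ , e₁∈ , to-incident e₁∈E e₁∼w)
                                                           (e₂ , e₂∈ , to-incident e₂∈E e₂∼w)))
                where
                  e₁∈E : e₁ ∈ E
                  e₁∈E = subst (e₁ ∈_) E₁∪E₂≡ (x∈p∪q⁺ (inj₁ e₁∈))
                  e₂∈E : e₂ ∈ E
                  e₂∈E = subst (e₂ ∈_) E₁∪E₂≡ (x∈p∪q⁺ (inj₂ e₂∈))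

      iso : SubIso Γ Γ' (V , E) (B'.endpoints E , E)
      iso = to s , id , to∈ , to-injective , to-surjective ,
            (λ _ e∈E → e∈E) , (λ _ _ _ _ eq → eq) , (λ e e∈E → e , e∈E , refl) ,
            λ e e∈E → to-joins s e (E⊆H e∈E) (E-side e∈E)
        where
          to∈ : ∀ v → v ∈ V → to s v ∈ B'.endpoints E
          to∈ v v∈V with h , h∈E , h∼v ← edge-at v∈V =
            B'.∈endpoints⁺ h∈E (to-incident h∈E h∼v)
          to-injective : ∀ u v → u ∈ V → v ∈ V → to s u ≡ to s v → u ≡ v
          to-injective u v u∈V v∈V eq = trans (sym (from-to-V u∈V)) (trans (cong (from s) eq) (from-to-V v∈V))
          to-surjective : ∀ v' → v' ∈ B'.endpoints E → ∃[ v ] (v ∈ V × to s v ≡ v')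
          to-surjective v' v'∈ = from s v' , from-endpoints v'∈

module BlockCorrespondence (I : SideIso) where
  open SideIso I
  open BlockTransfer I using (Γ; Γ')
  private
    module L = BlockTransfer I
    module R = BlockTransfer (SideIso-sym I)
    module B = Blocks Γ H
    module B' = Blocks Γ' H

  block-with-edge : ∀ {V E e₀} → IsBlock Γ B.X (V , E) → e₀ ∈ E →
                    IsBlock Γ' B'.X (B'.endpoints E , E) × SubIso Γ Γ' (V , E) (B'.endpoints E , E)
  block-with-edge {V} {E} {e₀} (blockLike , maximal) e₀∈E =
    (T.transfer e₀∈E blockLike , maximal') , T.iso e₀∈E blockLike
    where
      module T = L.OneSide (side e₀) (proj₂ (proj₁ (proj₂ blockLike))) (L.one-sided blockLike e₀∈E)
      -- a larger block-like subgraph of Γ' lies on the same side and pulls back to Γ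
      maximal' : ∀ B'' → SubLe Γ' (B'.endpoints E , E) B'' → BlockLike Γ' B'.X B'' →
                 SubLe Γ' B'' (B'.endpoints E , E)
      maximal' (V'' , E'') (_ , E⊆E'') blockLike'' =
        subst (_⊆ B'.endpoints E) (sym V''≡) (B'.endpoints-mono E''⊆E) , E''⊆E
        where
          e₀∈E'' : e₀ ∈ E''
          e₀∈E'' = E⊆E'' e₀∈E
          V''≡ : V'' ≡ B'.endpoints E''
          V''≡ = B'.blockLike-vertices blockLike'' e₀∈E''
          module T'' = R.OneSide (side e₀) (proj₂ (proj₁ (proj₂ blockLike''))) (R.one-sided blockLike'' e₀∈E'')
          pulled-back : BlockLike Γ B.X (B.endpoints E'' , E'')
          pulled-back = T''.transfer e₀∈E'' (subst (λ V → BlockLike Γ' B'.X (V , E'')) V''≡ blockLike'')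
          V⊆V'' : V ⊆ B.endpoints E''
          V⊆V'' = subst (_⊆ B.endpoints E'') (sym (B.blockLike-vertices blockLike e₀∈E))
                        (B.endpoints-mono E⊆E'')
          E''⊆E : E'' ⊆ E
          E''⊆E = proj₂ (maximal _ (V⊆V'' , E⊆E'') pulled-back)

  Matching : Sub Γ → Sub Γ' → Set
  Matching B B' = proj₂ B ≡ proj₂ B' × SubIso Γ Γ' B B'

  module _ (H-connected : ConnectedWith Γ H) (H-connected' : ConnectedWith Γ' H) where

    matching-block : ∀ {B} → IsBlock Γ B.X B → ∃[ B' ] (IsBlock Γ' B'.X B' × Matching B B')
    matching-block {V , E} block@((_ , _ , ((v₀ , v₀∈V) , _) , _) , _) with nonempty? E
    ... | yes (e₀ , e₀∈E) = (B'.endpoints E , E) , Product.map₂ (refl ,_) (block-with-edge block e₀∈E)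
    ... | no ¬nonempty = (⊤ , E) , B'.edgeless-isBlock no-H one-vertex' (to true v₀) empty , refl ,
        (to true , id , (λ _ _ → ∈⊤) , (λ u v _ _ _ → one-vertex u v) , (λ _ _ → v₀ , v₀∈V , one-vertex' _ _) ,
         (λ e e∈E → contradiction e∈E (empty e)) , (λ e _ e∈E → contradiction e∈E (empty e)) ,
         (λ e e∈E → contradiction e∈E (empty e)) , (λ e e∈E → contradiction e∈E (empty e)))
      where
        empty : ∀ h → h ∉ E
        empty h h∈E = ¬nonempty (h , h∈E)
        no-H : ∀ h → h ∉ H
        no-H = proj₁ (B.edgeless-block H-connected block empty)
        one-vertex : ∀ u v → u ≡ v
        one-vertex = B.no-H⇒one-vertex H-connected no-H
        one-vertex' : ∀ u v → u ≡ v
        one-vertex' = B'.no-H⇒one-vertex H-connected' no-H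

lookup-injective : ∀ {A : Set} {L : List A} → Unique L → ∀ i j → lookup L i ≡ lookup L j → i ≡ j
lookup-injective (_ ∷ _) zero zero _ = refl
lookup-injective (x∉ ∷ _) zero (suc j) eq = contradiction eq (All.lookup x∉ (∈-lookup j))
lookup-injective (x∉ ∷ _) (suc i) zero eq = contradiction (sym eq) (All.lookup x∉ (∈-lookup i))
lookup-injective (_ ∷ unique) (suc i) (suc j) eq = cong suc (lookup-injective unique i j eq)

matching-bijection : ∀ {A B : Set} {L : List A} {L' : List B} → Unique L → Unique L' → (R : A → B → Set) →
  (∀ {x} → x ∈ₗ L → ∃[ y ] (y ∈ₗ L' × R x y)) →
  (∀ {y} → y ∈ₗ L' → ∃[ x ] (x ∈ₗ L × R x y)) →
  (∀ {x y y'} → x ∈ₗ L → y ∈ₗ L' → y' ∈ₗ L' → R x y → R x y' → y ≡ y') →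
  (∀ {x x' y} → x ∈ₗ L → x' ∈ₗ L → y ∈ₗ L' → R x y → R x' y → x ≡ x') →
  Σ (Fin (length L) ⤖ Fin (length L')) λ π → ∀ i → R (lookup L i) (lookup L' (Bijection.to π i))
matching-bijection {L = L} {L'} unique unique' R forth back functional injective =
  mk⤖ {to = π} (π-injective , π-surjective) , matches
  where
    image : ∀ i → ∃[ y ] (y ∈ₗ L' × R (lookup L i) y)
    image i = forth (∈-lookup i)

    π : Fin (length L) → Fin (length L')
    π i = index (proj₁ (proj₂ (image i)))

    matches : ∀ i → R (lookup L i) (lookup L' (π i))
    matches i = subst (R (lookup L i)) (lookup-index (proj₁ (proj₂ (image i)))) (proj₂ (proj₂ (image i)))

    π-injective : ∀ {i j} → π i ≡ π j → i ≡ j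
    π-injective {i} {j} eq = lookup-injective unique i j
      (injective (∈-lookup i) (∈-lookup j) (∈-lookup (π j))
                 (subst (λ k → R (lookup L i) (lookup L' k)) eq (matches i)) (matches j))

    π-surjective : ∀ j → ∃ λ i → ∀ {z} → z ≡ i → π z ≡ j
    π-surjective j with x , x∈L , r ← back (∈-lookup j) =
      index x∈L , λ { refl → lookup-injective unique' _ j
        (functional (∈-lookup (index x∈L)) (∈-lookup _) (∈-lookup j) (matches (index x∈L))
                    (subst (λ z → R z (lookup L' j)) (lookup-index x∈L) r)) }

sideIso⇒sameBlockMultiset : (I : SideIso) → let open SideIso I in
  ConnectedWith (graphOn a n en) H → ConnectedWith (graphOn a' n en') H →
  SameBlockMultiset (graphOn a n en) (graphOn a' n en') (⊤ , H) (⊤ , H)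
sideIso⇒sameBlockMultiset I H-connected H-connected' L L' (unique , L-blocks) (unique' , L'-blocks) =
  Product.map₂ (proj₂ ∘_) (matching-bijection unique unique' Matching forth back functional injective)
  where
    open SideIso I
    open BlockTransfer I using (Γ; Γ')
    open BlockCorrespondence I
    module Sym = BlockCorrespondence (SideIso-sym I)

    listed : ∀ {B} → B ∈ₗ L → IsBlock Γ (⊤ , H) B
    listed = Equivalence.to (L-blocks _)

    listed' : ∀ {B'} → B' ∈ₗ L' → IsBlock Γ' (⊤ , H) B'
    listed' = Equivalence.to (L'-blocks _)

    forth : ∀ {B} → B ∈ₗ L → ∃[ B' ] (B' ∈ₗ L' × Matching B B')
    forth B∈ with B' , block' , matching ← matching-block H-connected H-connected' (listed B∈) =
      B' , Equivalence.from (L'-blocks B') block' , matching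

    back : ∀ {B'} → B' ∈ₗ L' → ∃[ B ] (B ∈ₗ L × Matching B B')
    back {B'} B'∈ with B , block , (E'≡E , _) ← Sym.matching-block H-connected' H-connected (listed' B'∈)
                   with B'' , block'' , (E≡E'' , iso) ← matching-block H-connected H-connected' block =
      B , Equivalence.from (L-blocks B) block , sym E'≡E , subst (SubIso Γ Γ' B) B''≡B' iso
      where
        B''≡B' : B'' ≡ B'
        B''≡B' = Blocks.block-unique Γ' H H-connected' block'' (listed' B'∈) (sym (trans E'≡E E≡E''))

    functional : ∀ {B B₁' B₂'} → B ∈ₗ L → B₁' ∈ₗ L' → B₂' ∈ₗ L' → Matching B B₁' → Matching B B₂' → B₁' ≡ B₂'
    functional _ B₁'∈ B₂'∈ (E≡E₁' , _) (E≡E₂' , _) =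
      Blocks.block-unique Γ' H H-connected' (listed' B₁'∈) (listed' B₂'∈) (trans (sym E≡E₁') E≡E₂')

    injective : ∀ {B₁ B₂ B'} → B₁ ∈ₗ L → B₂ ∈ₗ L → B' ∈ₗ L' → Matching B₁ B' → Matching B₂ B' → B₁ ≡ B₂
    injective B₁∈ B₂∈ _ (E₁≡E' , _) (E₂≡E' , _) =
      Blocks.block-unique Γ H H-connected (listed B₁∈) (listed B₂∈) (trans E₁≡E' (sym E₂≡E'))

module Contractions {G : Graph} where
  open Walks G

  cls-reach : ∀ {C} (κ : Contraction G C) {u v} → Reach G C u v → cls κ u ≡ cls κ v
  cls-reach κ {u} {v} = Equivalence.from (cls-ker κ u v)

  reach-cls : ∀ {C} (κ : Contraction G C) {u v} → cls κ u ≡ cls κ v → Reach G C u v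
  reach-cls κ {u} {v} = Equivalence.to (cls-ker κ u v)

  contracted-joins : ∀ {C} (κ : Contraction G C) {g u w} → Joins G g u w →
                     Joins (contractGraph G C κ) g (cls κ u) (cls κ w)
  contracted-joins κ (inj₁ refl) = inj₁ refl
  contracted-joins κ (inj₂ refl) = inj₂ refl

  contracted-incident : ∀ {C} (κ : Contraction G C) {h w} → Incident (contractGraph G C κ) h w →
                        ∃[ x ] (Incident G h x × cls κ x ≡ w)
  contracted-incident κ {h} (inj₁ q) = proj₁ (ends G h) , inj₁ refl , q
  contracted-incident κ {h} (inj₂ q) = proj₂ (ends G h) , inj₂ refl , q

  HC-connected : ∀ {C} (κ : Contraction G C) H → ConnectedWith G (C ∪ H) → ConnectedWith (contractGraph G C κ) H
  HC-connected {C} κ H connected c c'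
    with u , refl ← cls-surj κ c | v , refl ← cls-surj κ c' = contract (connected u v)
    where
      contract : ∀ {u v} → Reach G (C ∪ H) u v → Reach (contractGraph G C κ) H (cls κ u) (cls κ v)
      contract here = here
      contract (step g g∈ j p) with x∈p∪q⁻ C H g∈
      ... | inj₁ g∈C =
        subst (λ c → Reach (contractGraph G C κ) H c (cls κ _)) (sym (cls-reach κ (edge g∈C j))) (contract p)
      ... | inj₂ g∈H = step g g∈H (contracted-joins κ j) (contract p)

  -- H_C and H_C' are glued from the same two sides when C and C' link the same vertices within each side.
  module SideExchange {H C C' : EdgeSet G} (κ : Contraction G C) (κ' : Contraction G C')
    (side : Fin (ne G) → Bool) (Side : Bool → Fin (nv G) → Set) (Side? : ∀ s x → Dec (Side s x))
    (H-side : ∀ {s h v} → h ∈ H → side h ≡ s → Incident G h v → Side s v)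
    (C⇒C' : ∀ {s x y} → Side s x → Side s y → Reach G C x y → Reach G C' x y)
    (C'⇒C : ∀ {s x y} → Side s x → Side s y → Reach G C' x y → Reach G C x y)
    (shared-unique : SharedUnique (contractGraph G C κ) H side)
    (shared-unique' : SharedUnique (contractGraph G C' κ') H side)
    where

    private
      pick : ∀ {D} (ρ : Contraction G D) → Bool → Fin (k ρ) → Fin (nv G)
      pick ρ s c with any? (λ x → (cls ρ x ≟ c) ×-dec Side? s x)
      ... | yes (x , _) = x
      ... | no _ = proj₁ (cls-surj ρ c)

      pick-spec : ∀ {D} (ρ : Contraction G D) s {x} → Side s x →
                  Side s (pick ρ s (cls ρ x)) × Reach G D (pick ρ s (cls ρ x)) x
      pick-spec ρ s {x} x∈s with any? (λ y → (cls ρ y ≟ cls ρ x) ×-dec Side? s y)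
      ... | yes (y , y~x , y∈s) = y∈s , reach-cls ρ y~x
      ... | no none = contradiction (x , refl , x∈s) none

      to : Bool → Fin (k κ) → Fin (k κ')
      to s c = cls κ' (pick κ s c)

      from : Bool → Fin (k κ') → Fin (k κ)
      from s c = cls κ (pick κ' s c)

      to-cls : ∀ s {x} → Side s x → to s (cls κ x) ≡ cls κ' x
      to-cls s x∈s with y∈s , y→x ← pick-spec κ s x∈s = cls-reach κ' (C⇒C' y∈s x∈s y→x)

      from-cls : ∀ s {x} → Side s x → from s (cls κ' x) ≡ cls κ x
      from-cls s x∈s with y∈s , y→x ← pick-spec κ' s x∈s = cls-reach κ (C'⇒C y∈s x∈s y→x)

      from-to-cls : ∀ s {x} → Side s x → from s (to s (cls κ x)) ≡ cls κ x
      from-to-cls s x∈s = trans (cong (from s) (to-cls s x∈s)) (from-cls s x∈s)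

      to-from-cls : ∀ s {x} → Side s x → to s (from s (cls κ' x)) ≡ cls κ' x
      to-from-cls s x∈s = trans (cong (to s) (from-cls s x∈s)) (to-cls s x∈s)

    sideIso : SideIso
    sideIso = record
      { n = ne G ; a = k κ ; a' = k κ' ; en = ends (contractGraph G C κ) ; en' = ends (contractGraph G C' κ')
      ; H = H ; side = side ; to = to ; from = from
      ; to-joins = λ s h h∈H sh →
          inj₁ (cong₂ _,_ (sym (to-cls s (H-side h∈H sh (inj₁ refl))))
                          (sym (to-cls s (H-side h∈H sh (inj₂ refl)))))
      ; from-joins = λ s h h∈H sh →
          inj₁ (cong₂ _,_ (sym (from-cls s (H-side h∈H sh (inj₁ refl))))
                          (sym (from-cls s (H-side h∈H sh (inj₂ refl)))))
      ; from-to = λ s h v h∈H sh h∼v → let x , h∼x , x↦v = contracted-incident κ h∼v in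
          subst (λ v → from s (to s v) ≡ v) x↦v (from-to-cls s (H-side h∈H sh h∼x))
      ; to-from = λ s h v h∈H sh h∼v → let x , h∼x , x↦v = contracted-incident κ' h∼v in
          subst (λ v → to s (from s v) ≡ v) x↦v (to-from-cls s (H-side h∈H sh h∼x))
      ; shared-unique = shared-unique
      ; shared-unique' = shared-unique'
      }

    sameBlockMultiset : ConnectedWith G (C ∪ H) → ConnectedWith G (C' ∪ H) →
      SameBlockMultiset (contractGraph G C κ) (contractGraph G C' κ') (HC G H C κ) (HC G H C' κ')
    sameBlockMultiset connected connected' =
      sideIso⇒sameBlockMultiset sideIso (HC-connected κ H connected) (HC-connected κ' H connected')

module CocycleShores {G : Graph} {K : EdgeSet G} (cocycle : IsCocycle G K) where
  open Walks G

  minus-connected : ∀ {g} → g ∈ K → ConnectedWith G (∁ (K - g))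
  minus-connected {g} g∈K with connected? (∁ (K - g))
  ... | yes connected = connected
  ... | no disconnected =
    contradiction refl (x∈p-y⇒x≢y K (proj₂ cocycle (K - g) (p─q⊆p K ⁅ g ⁆) disconnected g∈K))

  private
    ∁[K-g]-g⊆∁K : ∀ g → ∁ (K - g) - g ⊆ ∁ K
    ∁[K-g]-g⊆∁K g g'∈ = x∉p⇒x∈∁p λ g'∈K → x∈∁p⇒x∉p (p─q⊆p _ _ g'∈) (without g'∈K (x∈p-y⇒x≢y _ g'∈))

  module _ {g} (g∈K : g ∈ K) where

    shore-of : ∀ y → Reach G (∁ K) (proj₁ (ends G g)) y ⊎ Reach G (∁ K) (proj₂ (ends G g)) y
    shore-of y with split g (∁[K-g]-g⊆∁K g) (minus-connected g∈K (proj₁ (ends G g)) y)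
    ... | inj₁ r = inj₁ r
    ... | inj₂ (_ , (_ , inj₁ refl , r)) = inj₁ r
    ... | inj₂ (_ , (_ , inj₂ refl , r)) = inj₂ r

    ends-separated : ¬ Reach G (∁ K) (proj₁ (ends G g)) (proj₂ (ends G g))
    ends-separated r = proj₁ cocycle λ u v → reverse (from-end₁ u) ++ from-end₁ v
      where
        from-end₁ : ∀ y → Reach G (∁ K) (proj₁ (ends G g)) y
        from-end₁ y = Sum.[ id , r ++_ ] (shore-of y)

    crossing : ∀ {h} → h ∈ K → Σ (Fin (nv G)) λ x → Σ (Fin (nv G)) λ y →
               Joins G h x y × Reach G (∁ K) (proj₁ (ends G g)) x × Reach G (∁ K) (proj₂ (ends G g)) y
    crossing {h} h∈K with split h (∁[K-g]-g⊆∁K h) (minus-connected h∈K (proj₁ (ends G g)) (proj₂ (ends G g)))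
    ... | inj₁ r = contradiction r ends-separated
    ... | inj₂ ((_ , inj₁ refl , r₁) , (_ , inj₁ refl , r₂)) = contradiction (r₁ ++ r₂) ends-separated
    ... | inj₂ ((_ , inj₁ refl , r₁) , (_ , inj₂ refl , r₂)) = _ , _ , inj₁ refl , r₁ , reverse r₂
    ... | inj₂ ((_ , inj₂ refl , r₁) , (_ , inj₁ refl , r₂)) = _ , _ , inj₂ refl , r₁ , reverse r₂
    ... | inj₂ ((_ , inj₂ refl , r₁) , (_ , inj₂ refl , r₂)) = contradiction (r₁ ++ r₂) ends-separated

module Shores {G : Graph} (S₀ : EdgeSet G) (anchor : Bool → Fin (nv G))
               (separated : ¬ Reach G S₀ (anchor true) (anchor false)) where
  open Walks G

  Shore : Bool → Fin (nv G) → Set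
  Shore s = Reach G S₀ (anchor s)

  shores-disjoint : ∀ {s x} → Shore s x → Shore (not s) x → ⊥
  shores-disjoint {true} x∈ x∈' = separated (x∈ ++ reverse x∈')
  shores-disjoint {false} x∈ x∈' = separated (x∈' ++ reverse x∈)

  -- U-walks that use g only as the bridge between the shores
  module Bridge {U T : EdgeSet G} {g} (T⊆S₀ : T ⊆ S₀) (U-g⊆T : U - g ⊆ T)
                (gend : Bool → Fin (nv G)) (g-joins : Joins G g (gend true) (gend false))
                (gend-shore : ∀ s → Shore s (gend s)) where

    private
      end-on-shore : ∀ {s a} → Incident G g a → Shore s a → a ≡ gend s
      end-on-shore {true} g∼a a∈ with incident-joined g-joins g∼a
      ... | inj₁ eq = eq
      ... | inj₂ refl = ⊥-elim (shores-disjoint a∈ (gend-shore false))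
      end-on-shore {false} g∼a a∈ with incident-joined g-joins g∼a
      ... | inj₁ refl = ⊥-elim (shores-disjoint (gend-shore true) a∈)
      ... | inj₂ eq = eq

      to-S₀ : ∀ {x y} → Reach G T x y → Reach G S₀ x y
      to-S₀ = mono T⊆S₀

    same-shore : ∀ s {x y} → Reach G U x y → Shore s x → Shore s y → Reach G T x y
    same-shore s r x∈ y∈ with split g U-g⊆T r
    ... | inj₁ r' = r'
    ... | inj₂ ((a , g∼a , r₁) , (b , g∼b , r₂)) =
      subst (Reach G T _) (trans (end-on-shore g∼a (x∈ ++ to-S₀ r₁)) (sym (end-on-shore g∼b (y∈ ++ reverse (to-S₀ r₂)))))
            r₁ ++ r₂

    across : ∀ s {x y} → Reach G U x y → Shore (not s) x → Shore s y → Reach G T (gend s) y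
    across s r x∈ y∈ with split g U-g⊆T r
    ... | inj₁ r' = ⊥-elim (shores-disjoint (y∈ ++ reverse (to-S₀ r')) x∈)
    ... | inj₂ (_ , (b , g∼b , r₂)) =
      subst (λ z → Reach G T z _) (end-on-shore g∼b (y∈ ++ reverse (to-S₀ r₂))) r₂

module Exchange {G : Graph} (connected : Connected G) {H C : EdgeSet G} (contracting : IsContractingSet G H C)
                {e f} (e∈C : e ∈ C) (f∈D : f ∈ DeletingSet G H C) where
  open Walks G
  open Contractions

  C' : EdgeSet G
  C' = (C ∪ ⁅ f ⁆) - e

  f∈C' : f ∈ C'
  f∈C' = without (x∈p∪q⁺ (inj₂ (x∈⁅x⁆ f))) λ { refl → x∈∁p⇒x∉p f∈D (x∈p∪q⁺ (inj₁ e∈C)) }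

  C-e⊆C' : C - e ⊆ C'
  C-e⊆C' g∈ = without (x∈p∪q⁺ (inj₁ (p─q⊆p _ _ g∈))) (x∈p-y⇒x≢y C g∈)

  C'-f⊆C-e : C' - f ⊆ C - e
  C'-f⊆C-e g∈ =
    without (x∈p∪⁅y⁆∧x≢y⇒x∈p C (p─q⊆p _ _ (p─q⊆p _ _ g∈)) (x∈p-y⇒x≢y C' g∈)) (x∈p-y⇒x≢y _ (p─q⊆p _ _ g∈))

  C∪H-connected : ConnectedWith G (C ∪ H)
  C∪H-connected = Cuts.no-cocycle⇒connected G connected (C ∪ H) (proj₂ (proj₂ contracting))

  C'∪H-connected : Reach G (C' ∪ H) (proj₁ (ends G e)) (proj₂ (ends G e)) → ConnectedWith G (C' ∪ H)
  C'∪H-connected detour u v = reroute e C∪H-e⊆C'∪H detour (C∪H-connected u v)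
    where
      C∪H-e⊆C'∪H : (C ∪ H) - e ⊆ C' ∪ H
      C∪H-e⊆C'∪H g∈ with x∈p∪q⁻ C H (p─q⊆p _ _ g∈)
      ... | inj₁ g∈C = x∈p∪q⁺ (inj₁ (C-e⊆C' (without g∈C (x∈p-y⇒x≢y _ g∈))))
      ... | inj₂ g∈H = x∈p∪q⁺ (inj₂ g∈H)

  module ViaCycle {K} (K⊆C∪f : K ⊆ C ∪ ⁅ f ⁆) (cycle : IsCycle G K) (e∈K : e ∈ K) where

    K-f⊆C : K - f ⊆ C
    K-f⊆C g∈ = x∈p∪⁅y⁆∧x≢y⇒x∈p C (K⊆C∪f (p─q⊆p _ _ g∈)) (x∈p-y⇒x≢y K g∈)

    K-e⊆C' : K - e ⊆ C'
    K-e⊆C' g∈ = without (K⊆C∪f (p─q⊆p _ _ g∈)) (x∈p-y⇒x≢y K g∈)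

    -- C is acyclic, so the cycle uses f
    f∈K : f ∈ K
    f∈K with f ∈? K
    ... | yes f∈K = f∈K
    ... | no f∉K =
      contradiction (K , (λ {g} g∈K → K-f⊆C (without g∈K λ { refl → f∉K g∈K })) , cycle) (proj₁ (proj₂ contracting))

    C⇒C' : ∀ {x y} → Reach G C x y → Reach G C' x y
    C⇒C' = reroute e C-e⊆C' (mono K-e⊆C' (cycle-detour cycle e∈K))

    C'⇒C : ∀ {x y} → Reach G C' x y → Reach G C x y
    C'⇒C = reroute f (p─q⊆p C ⁅ e ⁆ ∘ C'-f⊆C-e) (mono K-f⊆C (cycle-detour cycle f∈K))

    sameBlockMultiset : (κ : Contraction G C) (κ' : Contraction G C') →
      SameBlockMultiset (contractGraph G C κ) (contractGraph G C' κ') (HC G H C κ) (HC G H C' κ')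
    sameBlockMultiset κ κ' =
      SideExchange.sameBlockMultiset κ κ' (λ _ → true) (λ _ _ → ⊤ᵤ) (λ _ _ → yes tt) (λ _ _ _ → tt)
        (λ _ _ → C⇒C') (λ _ _ → C'⇒C) (λ { (_ , (_ , _ , () , _)) _ }) (λ { (_ , (_ , _ , () , _)) _ })
        C∪H-connected (C'∪H-connected (C⇒C'∪H (edge e∈C (inj₁ refl))))
      where
        C⇒C'∪H : ∀ {x y} → Reach G C x y → Reach G (C' ∪ H) x y
        C⇒C'∪H = mono (λ g∈ → x∈p∪q⁺ (inj₁ g∈)) ∘ C⇒C'

  module ViaCocycle {K} (K⊆D∪e : K ⊆ DeletingSet G H C ∪ ⁅ e ⁆) (cocycle : IsCocycle G K) (f∈K : f ∈ K) where
    open CocycleShores cocycle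

    ∁K-avoids : ∀ {g} → g ∈ C ∪ H → g ≢ e → g ∈ ∁ K
    ∁K-avoids g∈C∪H g≢e = x∉p⇒x∈∁p λ g∈K → x∈∁p⇒x∉p (x∈p∪⁅y⁆∧x≢y⇒x∈p _ (K⊆D∪e g∈K) g≢e) g∈C∪H

    -- D contains no cocycle, so the cocycle uses e
    e∈K : e ∈ K
    e∈K with e ∈? K
    ... | yes e∈K = e∈K
    ... | no e∉K = contradiction (K , (λ {g} g∈K → x∈p∪⁅y⁆∧x≢y⇒x∈p _ (K⊆D∪e g∈K) λ { refl → e∉K g∈K }) , cocycle)
                                 (proj₂ (proj₂ contracting))

    anchor : Bool → Fin (nv G)
    anchor true = proj₁ (ends G e)
    anchor false = proj₂ (ends G e)

    open Shores (∁ K) anchor (ends-separated e∈K)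

    f-crossing : Σ (Fin (nv G)) λ x → Σ (Fin (nv G)) λ y → Joins G f x y × Shore true x × Shore false y
    f-crossing = crossing e∈K f∈K

    fend : Bool → Fin (nv G)
    fend true = proj₁ f-crossing
    fend false = proj₁ (proj₂ f-crossing)

    f-joins : Joins G f (fend true) (fend false)
    f-joins = proj₁ (proj₂ (proj₂ f-crossing))

    fend-shore : ∀ s → Shore s (fend s)
    fend-shore true = proj₁ (proj₂ (proj₂ (proj₂ f-crossing)))
    fend-shore false = proj₂ (proj₂ (proj₂ (proj₂ f-crossing)))

    C-e⊆∁K : C - e ⊆ ∁ K
    C-e⊆∁K g∈ = ∁K-avoids (x∈p∪q⁺ (inj₁ (p─q⊆p _ _ g∈))) (x∈p-y⇒x≢y C g∈)

    H⊆∁K : H ⊆ ∁ K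
    H⊆∁K g∈H = ∁K-avoids (x∈p∪q⁺ (inj₂ g∈H)) λ { refl → proj₁ contracting e∈C g∈H }

    module BridgeE = Bridge C-e⊆∁K id anchor (inj₁ refl) (λ _ → here)
    module BridgeF = Bridge C-e⊆∁K C'-f⊆C-e fend f-joins fend-shore

    side : Fin (ne G) → Bool
    side h = Sum.[ (λ _ → true) , (λ _ → false) ] (shore-of e∈K (proj₁ (ends G h)))

    private
      along-H : ∀ {h a v} → h ∈ H → Reach G (∁ K) a (proj₁ (ends G h)) → Incident G h v → Reach G (∁ K) a v
      along-H h∈H r (inj₁ refl) = r
      along-H h∈H r (inj₂ refl) = r ++ edge (H⊆∁K h∈H) (inj₁ refl)

    H-side : ∀ {s h v} → h ∈ H → side h ≡ s → Incident G h v → Shore s v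
    H-side {h = h} h∈H refl h∼v with shore-of e∈K (proj₁ (ends G h))
    ... | inj₁ r = along-H h∈H r h∼v
    ... | inj₂ r = along-H h∈H r h∼v

    shared-class : ∀ {D} (ρ : Contraction G D) {a} →
                   (∀ {x y} → Reach G D x y → Shore false x → Shore true y → Reach G D a y) →
                   ∀ {w} → Shared (contractGraph G D ρ) H side w → w ≡ cls ρ a
    shared-class ρ across-D ((h₁ , h₁∈H , s₁ , h₁∼w) , (h₂ , h₂∈H , s₂ , h₂∼w))
      with x₁ , h₁∼x₁ , refl ← contracted-incident ρ h₁∼w | x₂ , h₂∼x₂ , x₂~x₁ ← contracted-incident ρ h₂∼w =
      sym (cls-reach ρ (across-D (reach-cls ρ x₂~x₁) (H-side h₂∈H s₂ h₂∼x₂) (H-side h₁∈H s₁ h₁∼x₁)))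

    ends-reconnected : Reach G (C' ∪ H) (proj₁ (ends G e)) (proj₂ (ends G e))
    ends-reconnected =
      mono T⊆C'∪H (BridgeU.same-shore true (C∪H-connected _ _) here (fend-shore true)) ++
      edge (x∈p∪q⁺ (inj₁ f∈C')) f-joins ++
      mono T⊆C'∪H (BridgeU.same-shore false (C∪H-connected _ _) (fend-shore false) here)
      where
        T⊆∁K : (C - e) ∪ H ⊆ ∁ K
        T⊆∁K g∈ = Sum.[ C-e⊆∁K , H⊆∁K ] (x∈p∪q⁻ _ _ g∈)
        C∪H-e⊆T : (C ∪ H) - e ⊆ (C - e) ∪ H
        C∪H-e⊆T g∈ = x∈p∪q⁺ (Sum.map₁ (λ g∈C → without g∈C (x∈p-y⇒x≢y _ g∈)) (x∈p∪q⁻ C H (p─q⊆p _ _ g∈)))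
        T⊆C'∪H : (C - e) ∪ H ⊆ C' ∪ H
        T⊆C'∪H g∈ = x∈p∪q⁺ (Sum.map₁ C-e⊆C' (x∈p∪q⁻ _ _ g∈))
        module BridgeU = Bridge T⊆∁K C∪H-e⊆T anchor (inj₁ refl) (λ _ → here)

    sameBlockMultiset : (κ : Contraction G C) (κ' : Contraction G C') →
      SameBlockMultiset (contractGraph G C κ) (contractGraph G C' κ') (HC G H C κ) (HC G H C' κ')
    sameBlockMultiset κ κ' =
      SideExchange.sameBlockMultiset κ κ' side Shore (λ s → reach? (∁ K) (anchor s)) H-side
        (λ {s} x∈ y∈ r → mono C-e⊆C' (BridgeE.same-shore s r x∈ y∈))
        (λ {s} x∈ y∈ r → mono (p─q⊆p C ⁅ e ⁆) (BridgeF.same-shore s r x∈ y∈))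
        (λ w∈ w'∈ → trans (shared-class κ acrossE w∈) (sym (shared-class κ acrossE w'∈)))
        (λ w∈ w'∈ → trans (shared-class κ' acrossF w∈) (sym (shared-class κ' acrossF w'∈)))
        C∪H-connected (C'∪H-connected ends-reconnected)
      where
        acrossE : ∀ {x y} → Reach G C x y → Shore false x → Shore true y → Reach G C (anchor true) y
        acrossE r x∈ y∈ = mono (p─q⊆p C ⁅ e ⁆) (BridgeE.across true r x∈ y∈)
        acrossF : ∀ {x y} → Reach G C' x y → Shore false x → Shore true y → Reach G C' (fend true) y
        acrossF r x∈ y∈ = mono C-e⊆C' (BridgeF.across true r x∈ y∈)

lemma3p14 : (G : Graph) → Connected G →
    (H C : EdgeSet G) → IsContractingSet G H C →
    (e f : Fin (ne G)) → e ∈ C → f ∈ DeletingSet G H C →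
    ((∃[ K ] (K ⊆ (C ∪ ⁅ f ⁆) × IsCycle G K × e ∈ K))
      ⊎ (∃[ K ] (K ⊆ (DeletingSet G H C ∪ ⁅ e ⁆) × IsCocycle G K × f ∈ K))) →
    (κ : Contraction G C) → (κ' : Contraction G ((C ∪ ⁅ f ⁆) - e)) →
    SameBlockMultiset (contractGraph G C κ) (contractGraph G ((C ∪ ⁅ f ⁆) - e) κ')
      (HC G H C κ) (HC G H ((C ∪ ⁅ f ⁆) - e) κ')
lemma3p14 G connected H C contracting e f e∈C f∈D (inj₁ (K , K⊆ , cycle , e∈K)) =
  Exchange.ViaCycle.sameBlockMultiset connected contracting e∈C f∈D K⊆ cycle e∈K
lemma3p14 G connected H C contracting e f e∈C f∈D (inj₂ (K , K⊆ , cocycle , f∈K)) =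
  Exchange.ViaCocycle.sameBlockMultiset connected contracting e∈C f∈D K⊆ cocycle f∈K
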